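{- Let $n\ge 2$ and $q>2$, and let $S$ be an $n$-window sequence over $\mathbb{Z}_q$ containing no zeros and such that every $n$-tuple appearing in $S$ has weight less than $nq/2$. Then $S$ is a negative orientable sequence of order $n$.
   Context: Sequences are periodic with entries in $\mathbb{Z}_q$. For $S=(s_i)$ write $\mathbf{s}_n(i)=(s_i,\ldots,s_{i+n-1})$; for an $n$-tuple $\mathbf{u}=(u_0,\ldots,u_{n-1})$ let $\mathbf{u}^R=(u_{n-1},\ldots,u_0)$ and $-\mathbf{u}=(-u_0,\ldots,-u_{n-1})$. A periodic sequence of period $m$ is an $n$-window sequence if $\mathbf{s}_n(i)=\mathbf{s}_n(j)$ implies $i\equiv j\pmod m$; it is a negative orientable sequence of order $n$ if also $\mathbf{s}_n(i)\neq-\mathbf{s}_n(j)^R$ for all $i,j$. The weight of an $n$-tuple $(u_0,\ldots,u_{n-1})$ is $\sum_i u_i$ computed in $\mathbb{Z}$, treating each $u_i$ as an integer in $[0,q-1]$. -}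

module Defs where

open import Data.Nat using (ℕ; zero; suc; _+_; _∸_; NonZero)
open import Data.Nat.DivMod using (_%_; _mod_)
open import Data.Fin using (Fin; toℕ; opposite)
import Data.Fin as F
open import Data.Product using (_×_)
open import Data.Vec.Functional using (Vector)
open import Relation.Binary.PropositionalEquality using (_≡_)
open import Relation.Nullary using (¬_)

-- Elements of ℤ_q are represented as Fin q (the integers 0 … q-1).

IsPeriodic : ∀ {q} → (ℕ → Fin q) → ℕ → Set
IsPeriodic s m = ∀ i → s (i + m) ≡ s i

_≋_ : ∀ {A : Set} {n} → Vector A n → Vector A n → Set
u ≋ v = ∀ k → u k ≡ v k

window : ∀ {q} (n : ℕ) → (ℕ → Fin q) → ℕ → Vector (Fin q) n
window n s i k = s (i + toℕ k)

rev : ∀ {A : Set} {n} → Vector A n → Vector A n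
rev u k = u (opposite k)

negℤq : ∀ {q} .{{_ : NonZero q}} → Fin q → Fin q
negℤq {q} x = (q ∸ toℕ x) mod q

negT : ∀ {q n} .{{_ : NonZero q}} → Vector (Fin q) n → Vector (Fin q) n
negT u k = negℤq (u k)

-- weight: sum of entries computed in ℕ, entries read as integers in [0, q-1]
weight : ∀ {q n} → Vector (Fin q) n → ℕ
weight {n = zero}  u = 0
weight {n = suc n} u = toℕ (u F.zero) + weight (λ k → u (F.suc k))

IsWindowSeq : ∀ {q} (n m : ℕ) .{{_ : NonZero m}} → (ℕ → Fin q) → Set
IsWindowSeq n m s =
  IsPeriodic s m × (∀ i j → window n s i ≋ window n s j → i % m ≡ j % m)

IsNegOrientable : ∀ {q} .{{_ : NonZero q}} (n m : ℕ) .{{_ : NonZero m}} → (ℕ → Fin q) → Set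
IsNegOrientable n m s =
  IsWindowSeq n m s × (∀ i j → ¬ (window n s i ≋ negT (rev (window n s j))))

{-# OPTIONS --safe #-}
module Submission where

-- If a window equals the negated reverse of another window, then, since no entry is 0,
-- each entry x pairs with q - x, so the two windows' weights add up to n q.  But both
-- weights are below n q / 2.

open import Defs
open import Data.Nat using (ℕ; zero; suc; _+_; _∸_; _≤_; _<_; _*_; NonZero)
open import Data.Nat.Properties
  using (+-assoc; +-comm; +-identityʳ; *-distribˡ-+; +-mono-<; <-irrefl; <⇒≤; n≢0⇒n>0; ∸-monoʳ-<; m∸n+n≡m;
         +-commutativeSemigroup)
open import Algebra.Properties.CommutativeSemigroup +-commutativeSemigroup using (interchange)
open import Data.Nat.DivMod using (m<n⇒m%n≡m)
open import Data.Fin using (Fin; toℕ; fromℕ; inject₁)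
import Data.Fin as F
open import Data.Fin.Properties using (toℕ-fromℕ<; toℕ<n)
open import Data.Product using (_,_)
open import Data.Vec.Functional using (Vector)
open import Relation.Binary.PropositionalEquality
open import Relation.Nullary using (¬_)

weight-cong : ∀ {q n} {u v : Vector (Fin q) n} → u ≋ v → weight u ≡ weight v
weight-cong {n = zero}  u≋v = refl
weight-cong {n = suc n} u≋v = cong₂ _+_ (cong toℕ (u≋v F.zero)) (weight-cong (λ k → u≋v (F.suc k)))

weight-init+last : ∀ {q} n (u : Vector (Fin q) (suc n)) →
                   weight (λ k → u (inject₁ k)) + toℕ (u (fromℕ n)) ≡ weight u
weight-init+last zero    u = sym (+-identityʳ (toℕ (u F.zero)))
weight-init+last (suc n) u =
  trans (+-assoc (toℕ (u F.zero)) _ _)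
        (cong (toℕ (u F.zero) +_) (weight-init+last n (λ k → u (F.suc k))))

weight-rev : ∀ {q} n (u : Vector (Fin q) n) → weight (rev u) ≡ weight u
weight-rev zero    u = refl
weight-rev (suc n) u = begin
  toℕ (u (fromℕ n)) + weight (rev (λ k → u (inject₁ k))) ≡⟨ cong (toℕ (u (fromℕ n)) +_) (weight-rev n _) ⟩
  toℕ (u (fromℕ n)) + weight (λ k → u (inject₁ k))       ≡⟨ +-comm (toℕ (u (fromℕ n))) _ ⟩
  weight (λ k → u (inject₁ k)) + toℕ (u (fromℕ n))       ≡⟨ weight-init+last n u ⟩
  weight u                                                ∎
  where open ≡-Reasoning

weight+weight≡n*c : ∀ {q} n (u v : Vector (Fin q) n) {c : ℕ} →
                    (∀ k → toℕ (u k) + toℕ (v k) ≡ c) → weight u + weight v ≡ n * c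
weight+weight≡n*c zero    u v sum≡c = refl
weight+weight≡n*c (suc n) u v sum≡c =
  trans (interchange (toℕ (u F.zero)) _ (toℕ (v F.zero)) _)
        (cong₂ _+_ (sum≡c F.zero) (weight+weight≡n*c n _ _ (λ k → sum≡c (F.suc k))))

toℕ-negℤq : ∀ {q} .{{_ : NonZero q}} (x : Fin q) → toℕ x ≢ 0 → toℕ (negℤq x) ≡ q ∸ toℕ x
toℕ-negℤq x x≢0 =
  trans (toℕ-fromℕ< _) (m<n⇒m%n≡m (∸-monoʳ-< (n≢0⇒n>0 x≢0) (<⇒≤ (toℕ<n x))))

negℤq+id≡q : ∀ {q} .{{_ : NonZero q}} (x : Fin q) → toℕ x ≢ 0 → toℕ (negℤq x) + toℕ x ≡ q
negℤq+id≡q x x≢0 = trans (cong (_+ toℕ x) (toℕ-negℤq x x≢0)) (m∸n+n≡m (<⇒≤ (toℕ<n x)))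

weight-negT-rev : ∀ {q} .{{_ : NonZero q}} n (u : Vector (Fin q) n) → (∀ k → toℕ (u k) ≢ 0) →
                  weight (negT (rev u)) + weight u ≡ n * q
weight-negT-rev {q} n u u≢0 = begin
  weight (negT (rev u)) + weight u       ≡⟨ cong (weight (negT (rev u)) +_) (weight-rev n u) ⟨
  weight (negT (rev u)) + weight (rev u) ≡⟨ weight+weight≡n*c n _ _ (λ k → negℤq+id≡q (rev u k) (u≢0 _)) ⟩
  n * q                                  ∎
  where open ≡-Reasoning

2*m<o⇒2*n<o⇒m+n≢o : ∀ m n {o} → 2 * m < o → 2 * n < o → m + n ≢ o
2*m<o⇒2*n<o⇒m+n≢o m n {o} 2m<o 2n<o m+n≡o = <-irrefl 2[m+n]≡2o 2[m+n]<2o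
  where
  2[m+n]≡2o : 2 * (m + n) ≡ 2 * o
  2[m+n]≡2o = cong (2 *_) m+n≡o
  2[m+n]<2o : 2 * (m + n) < 2 * o
  2[m+n]<2o = subst₂ _<_ (sym (*-distribˡ-+ 2 m n)) (cong (o +_) (sym (+-identityʳ o))) (+-mono-< 2m<o 2n<o)

theorem3 : (n q m : ℕ) → .{{_ : NonZero q}} → .{{_ : NonZero m}}
    → 2 ≤ n → 2 < q → (s : ℕ → Fin q)
    → IsWindowSeq n m s
    → (∀ i → toℕ (s i) ≢ 0)
    → (∀ i → 2 * weight (window n s i) < n * q)
    → IsNegOrientable n m s
theorem3 n q m _ _ s windowSeq s≢0 light = windowSeq , no-negated-reversal
  where
  no-negated-reversal : ∀ i j → ¬ (window n s i ≋ negT (rev (window n s j)))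
  no-negated-reversal i j wᵢ≋-wⱼᴿ = 2*m<o⇒2*n<o⇒m+n≢o wᵢ wⱼ (light i) (light j) (begin
    wᵢ + wⱼ                                 ≡⟨ cong (_+ wⱼ) (weight-cong wᵢ≋-wⱼᴿ) ⟩
    weight (negT (rev (window n s j))) + wⱼ ≡⟨ weight-negT-rev n (window n s j) (λ k → s≢0 _) ⟩
    n * q                                   ∎)
    where
    open ≡-Reasoning
    wᵢ wⱼ : ℕ
    wᵢ = weight (window n s i)
    wⱼ = weight (window n s j)
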